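{- Let $\mathcal I$ be a non-empty set with a directed preorder $\le$. For every $n\in\mathbb N$, the set $\mathfrak D_n$ is a proper filter on $\mathcal I^n$ (i.e. a non-empty collection of subsets of $\mathcal I^n$, closed under supersets and finite intersections, not containing $\emptyset$). Every $\mathcal H\in\mathfrak D_n$ is cofinal in $\mathcal I^n$ (with respect to the pointwise preorder), and $\uparrow C\in\mathfrak D_n$ for every $C\in\mathcal I^n$.
   Context: $\mathcal I$ is a non-empty set with a preorder $\le$ that is directed (any two elements have an upper bound). Write $\uparrow i=\{i'\in\mathcal I: i'\ge i\}$. Elements $C=(i_0,\dots,i_{n-1})\in\mathcal I^n$ are called contexts of length $n$; $()$ is the empty context, $Ci$ denotes $C$ extended by $i\in\mathcal I$, $\uparrow C=\uparrow i_0\times\dots\times\uparrow i_{n-1}$ (with $\uparrow()=\{()\}$), and $\le$ on $\mathcal I^n$ is defined pointwise. An up-set is a non-empty upward closed subset of $\mathcal I$. The sets $\mathfrak D_n\subseteq\mathcal P(\mathcal I^n)$ are defined recursively: $\mathcal H\in\mathfrak D_0$ iff $\mathcal H=\{()\}$; $\mathcal H\in\mathfrak D_1$ iff $\uparrow i\subseteq\mathcal H$ for some $i\in\mathcal I$; for $\mathcal H\subseteq\mathcal I^{n+1}$, $\mathcal H\in\mathfrak D_{n+1}$ iff $d_n(\mathcal H)\in\mathfrak D_n$, where $d_n(\mathcal H)=\{C\in\mathcal I^n: C^{\mathcal H}\in\mathfrak D_1\}$ and $C^{\mathcal H}=\{i\in\mathcal I: Ci\in\mathcal H\}$. -}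

module Defs where

open import Level using (Level; _⊔_)
open import Data.Nat using (ℕ; zero; suc)
open import Data.Vec using (Vec; []; _∷_; _∷ʳ_)
open import Data.Vec.Relation.Binary.Pointwise.Inductive using (Pointwise)
open import Data.Product using (Σ; ∃; _×_; _,_)
open import Relation.Nullary using (¬_)
open import Relation.Binary using (Rel)
open import Relation.Unary using (Pred; _⊆_; _∩_)

Directed : ∀ {a ℓ} {I : Set a} → Rel I ℓ → Set (a ⊔ ℓ)
Directed {I = I} _≤_ = ∀ (i j : I) → ∃ λ k → (i ≤ k) × (j ≤ k)

module _ {a ℓ} {I : Set a} (_≤_ : Rel I ℓ) where

  Subset : ℕ → Set (Level.suc (a ⊔ ℓ))
  Subset n = Pred (Vec I n) (a ⊔ ℓ)

  _≤ᶜ_ : ∀ {n} → Vec I n → Vec I n → Set (a ⊔ ℓ)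
  _≤ᶜ_ = Pointwise _≤_

  ↑ᶜ : ∀ {n} → Vec I n → Subset n
  ↑ᶜ C C' = C ≤ᶜ C'

  ContainsUp : Pred I (a ⊔ ℓ) → Set (a ⊔ ℓ)
  ContainsUp X = ∃ λ i → ∀ j → i ≤ j → X j

  fiber : ∀ {n} → Subset (suc n) → Vec I n → Pred I (a ⊔ ℓ)
  fiber H C i = H (C ∷ʳ i)

  -- d_n(H) = {C : C^H ∈ 𝔇₁}
  d : ∀ n → Subset (suc n) → Subset n
  d n H C = ContainsUp (fiber H C)

  𝔇 : ∀ n → Pred (Subset n) (a ⊔ ℓ)
  𝔇 zero H = H []                      -- H = {()}  (I^0 = {()})
  𝔇 (suc zero) H = ContainsUp (λ i → H (i ∷ []))
  𝔇 (suc (suc n)) H = 𝔇 (suc n) (d (suc n) H)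

  IsEmpty : ∀ {n} → Subset n → Set (a ⊔ ℓ)
  IsEmpty H = ∀ C → ¬ H C

  record IsProperFilter {n} (F : Pred (Subset n) (a ⊔ ℓ)) : Set (Level.suc (a ⊔ ℓ)) where
    field
      nonempty : ∃ λ H → F H
      upward   : ∀ {H H' : Subset n} → H ⊆ H' → F H → F H'
      meet     : ∀ {H H' : Subset n} → F H → F H' → F (H ∩ H')
      proper   : ∀ {H : Subset n} → F H → ¬ IsEmpty H

  Cofinal : ∀ {n} → Subset n → Set (a ⊔ ℓ)
  Cofinal {n} H = ∀ (C : Vec I n) → ∃ λ C' → (C ≤ᶜ C') × H C'

module Submission where

-- 𝔇 (n + 1) is the preimage of 𝔇 n under d n, so every filter property is proved by induction on n
-- from the corresponding property of d n: d n is monotone, and it commutes with binary meets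
-- because two up-sets ↑ i and ↑ i' of I share the up-set of a common upper bound. Cofinality
-- likewise extends a cofinal context C' ≥ C with d-witness i by an upper bound of i and the
-- last entry of C. Properness follows from cofinality, and ↑ C ∈ 𝔇 n needs no hypothesis at all.

open import Defs
open import Data.Nat using (ℕ; zero; suc)
open import Data.Vec using (Vec; []; _∷_; _∷ʳ_; initLast; replicate)
open import Data.Vec.Relation.Binary.Pointwise.Inductive using (Pointwise; []; _∷_)
open import Data.Product using (_×_; _,_)
open import Relation.Binary using (Rel; REL; IsPreorder; Transitive)
open import Relation.Binary.PropositionalEquality using (_≡_; refl)
open import Relation.Unary using (_⊆_; _∩_)

∷ʳ⁺ : ∀ {a b ℓ} {A : Set a} {B : Set b} {_∼_ : REL A B ℓ} {n} {xs : Vec A n} {ys : Vec B n} {x y} →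
      Pointwise _∼_ xs ys → x ∼ y → Pointwise _∼_ (xs ∷ʳ x) (ys ∷ʳ y)
∷ʳ⁺ []         x∼y = x∼y ∷ []
∷ʳ⁺ (p ∷ xs∼ys) x∼y = p ∷ ∷ʳ⁺ xs∼ys x∼y

module _ {a ℓ} {I : Set a} (_≤_ : Rel I ℓ) where

  𝔇-suc⁻ : ∀ n {H} → 𝔇 _≤_ (suc n) H → 𝔇 _≤_ n (d _≤_ n H)
  𝔇-suc⁻ zero    H∈𝔇 = H∈𝔇
  𝔇-suc⁻ (suc n) H∈𝔇 = H∈𝔇

  𝔇-suc⁺ : ∀ n {H} → 𝔇 _≤_ n (d _≤_ n H) → 𝔇 _≤_ (suc n) H
  𝔇-suc⁺ zero    dH∈𝔇 = dH∈𝔇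
  𝔇-suc⁺ (suc n) dH∈𝔇 = dH∈𝔇

  d-mono : ∀ n {H H' : Subset _≤_ (suc n)} → H ⊆ H' → d _≤_ n H ⊆ d _≤_ n H'
  d-mono n H⊆H' (i , ↑i⊆fiber) = i , λ j i≤j → H⊆H' (↑i⊆fiber j i≤j)

  𝔇-upward : ∀ n {H H' : Subset _≤_ n} → H ⊆ H' → 𝔇 _≤_ n H → 𝔇 _≤_ n H'
  𝔇-upward zero    H⊆H' H∈𝔇 = H⊆H' H∈𝔇
  𝔇-upward (suc n) {H} {H'} H⊆H' H∈𝔇 =
    𝔇-suc⁺ n {H'} (𝔇-upward n (d-mono n {H} {H'} H⊆H') (𝔇-suc⁻ n {H} H∈𝔇))

  ↑ᶜ⊆d↑ᶜ-∷ʳ : ∀ n (C : Vec I n) x → ↑ᶜ _≤_ C ⊆ d _≤_ n (↑ᶜ _≤_ (C ∷ʳ x))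
  ↑ᶜ⊆d↑ᶜ-∷ʳ n C x C≤C' = x , λ j x≤j → ∷ʳ⁺ C≤C' x≤j

  ↑ᶜ∈𝔇 : ∀ n (C : Vec I n) → 𝔇 _≤_ n (↑ᶜ _≤_ C)
  ↑ᶜ∈𝔇 zero    [] = []
  ↑ᶜ∈𝔇 (suc n) C with initLast C
  ... | C₀ , x , refl =
    𝔇-suc⁺ n {↑ᶜ _≤_ (C₀ ∷ʳ x)} (𝔇-upward n (↑ᶜ⊆d↑ᶜ-∷ʳ n C₀ x) (↑ᶜ∈𝔇 n C₀))

  module _ (dir : Directed _≤_) where

    d-∩ : Transitive _≤_ → ∀ n {H H' : Subset _≤_ (suc n)} →
          (d _≤_ n H ∩ d _≤_ n H') ⊆ d _≤_ n (H ∩ H')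
    d-∩ trans n ((i , ↑i⊆H) , (i' , ↑i'⊆H')) with dir i i'
    ... | k , i≤k , i'≤k = k , λ j k≤j → ↑i⊆H j (trans i≤k k≤j) , ↑i'⊆H' j (trans i'≤k k≤j)

    𝔇-∩ : Transitive _≤_ → ∀ n {H H' : Subset _≤_ n} → 𝔇 _≤_ n H → 𝔇 _≤_ n H' → 𝔇 _≤_ n (H ∩ H')
    𝔇-∩ trans zero    H∈𝔇 H'∈𝔇 = H∈𝔇 , H'∈𝔇
    𝔇-∩ trans (suc n) {H} {H'} H∈𝔇 H'∈𝔇 =
      𝔇-suc⁺ n {H ∩ H'} (𝔇-upward n (d-∩ trans n {H} {H'})
        (𝔇-∩ trans n (𝔇-suc⁻ n {H} H∈𝔇) (𝔇-suc⁻ n {H'} H'∈𝔇)))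

    𝔇⇒Cofinal : ∀ n H → 𝔇 _≤_ n H → Cofinal _≤_ H
    𝔇⇒Cofinal zero    H H∈𝔇 [] = [] , [] , H∈𝔇
    𝔇⇒Cofinal (suc n) H H∈𝔇 C with initLast C
    ... | C₀ , x , refl with 𝔇⇒Cofinal n (d _≤_ n H) (𝔇-suc⁻ n {H} H∈𝔇) C₀
    ... | C₀' , C₀≤C₀' , (i , ↑i⊆fiber) with dir i x
    ... | j , i≤j , x≤j = C₀' ∷ʳ j , ∷ʳ⁺ C₀≤C₀' x≤j , ↑i⊆fiber j i≤j

    𝔇-isProperFilter : Transitive _≤_ → I → ∀ n → IsProperFilter _≤_ (𝔇 _≤_ n)
    𝔇-isProperFilter trans i₀ n = record
      { nonempty = ↑ᶜ _≤_ C₀ , ↑ᶜ∈𝔇 n C₀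
      ; upward   = 𝔇-upward n
      ; meet     = 𝔇-∩ trans n
      ; proper   = λ {H} H∈𝔇 H-empty →
          let (C' , _ , C'∈H) = 𝔇⇒Cofinal n H H∈𝔇 C₀ in H-empty C' C'∈H
      }
      where
      C₀ : Vec I n
      C₀ = replicate n i₀

proposition2p2 : ∀ {a ℓ} {I : Set a} (_≤_ : Rel I ℓ) → IsPreorder _≡_ _≤_ → I → Directed _≤_ →
    ∀ (n : ℕ) → IsProperFilter _≤_ (𝔇 _≤_ n)
      × (∀ H → 𝔇 _≤_ n H → Cofinal _≤_ H)
      × (∀ (C : Vec I n) → 𝔇 _≤_ n (↑ᶜ _≤_ C))
proposition2p2 _≤_ isPreorder i₀ dir n =
  𝔇-isProperFilter _≤_ dir (IsPreorder.trans isPreorder) i₀ n , 𝔇⇒Cofinal _≤_ dir n , ↑ᶜ∈𝔇 _≤_ n
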